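{- Let $\lambda=(\lambda_1\ge\cdots\ge\lambda_k\ge 0)$ be a partition of some nonnegative integer (with $k$ rows, possibly empty). Then the number of distinct Young diagrams, with each row having equal or fewer boxes than the row above, that can be obtained from the Young diagram of $\lambda$ by removing zero or more boxes from the rows (i.e. the number of sequences $\mu_1\ge\cdots\ge\mu_k\ge0$ with $\mu_i\le\lambda_i$ for all $i$) equals $d_k$, where $d_1=\lambda_1+1$ and, for $k\ge2$, \[ d_k=\sum_{i=1}^{k-1}\left[\binom{\lambda_i+k-i+1}{k+1-i}-\binom{\lambda_i-\lambda_k+k-i}{k+1-i}\right]\gamma_i-\sum_{i=1}^{k-2}(\lambda_k+1)\binom{\lambda_i-\lambda_{k-1}+k-i-1}{k-i}\gamma_i, \] with $\gamma_1=1$ and $\gamma_j=-\sum_{i=1}^{j-2}\binom{\lambda_i-\lambda_{j-1}+j-i-1}{j-i}\gamma_i$ for $j\ge2$.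
   Context: An empty sum $\sum_{i=a}^{b}$ with $a>b$ is $0$; $\binom{a}{b}=0$ for integers $0\le a<b$. (In the paper, $d_k$ is the number of decreasing lattice paths below the decreasing lattice path from $(0,\lambda_1)$ to $(k,0)$ with height sequence $\lambda$, which is given by the displayed formula.) -}

module Defs where

open import Data.Nat using (ℕ; zero; suc; _≤_; _∸_; _≤?_)
  renaming (_+_ to _+ℕ_)
open import Data.Nat.Combinatorics using (_C_)
open import Data.Integer using (ℤ; +_; _+_; _-_; _*_; -_)
open import Data.Vec using (Vec; []; _∷_)
open import Data.Vec.Relation.Binary.Pointwise.Inductive using (Pointwise)
open import Data.Product using (Σ; _×_)
open import Relation.Nullary using (yes; no)

-- 1-based access λ_i to a vector; indices outside 1..k give 0 (never used).
at : ∀ {k} → Vec ℕ k → ℕ → ℕ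
at []      _             = 0
at (x ∷ v) zero          = 0
at (x ∷ v) (suc zero)    = x
at (x ∷ v) (suc (suc i)) = at v (suc i)

-- Weakly decreasing sequence x₁ ≥ x₂ ≥ ⋯ (inductive, so proofs are irrelevant).
data Decreasing : ∀ {n} → Vec ℕ n → Set where
  []  : Decreasing []
  [-] : ∀ {x} → Decreasing (x ∷ [])
  _∷_ : ∀ {x y n} {v : Vec ℕ n} → y ≤ x → Decreasing (y ∷ v) → Decreasing (x ∷ y ∷ v)

SubDiagram : ∀ {k} → Vec ℕ k → Set
SubDiagram {k} lam = Σ (Vec ℕ k) (λ μ → Decreasing μ × Pointwise _≤_ μ lam)

Σ1 : ℕ → (ℕ → ℤ) → ℤ
Σ1 zero    f = + 0
Σ1 (suc n) f = Σ1 n f + f (suc n)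

Cz : ℕ → ℕ → ℤ
Cz a b = + (a C b)

-- γ with fuel: G n j = γ_j whenever j ≤ n + 1.
-- γ_1 = 1, γ_j = - Σ_{i=1}^{j-2} C(λ_i - λ_{j-1} + j - i - 1, j - i) γ_i  (j ≥ 2).
G : ∀ {k} → Vec ℕ k → ℕ → ℕ → ℤ
G lam zero    j = + 1
G lam (suc n) j with j ≤? 1
... | yes _ = + 1
... | no  _ = - Σ1 (j ∸ 2) (λ i →
    Cz ((at lam i ∸ at lam (j ∸ 1)) +ℕ (j ∸ i ∸ 1)) (j ∸ i) * G lam n i)

γ : ∀ {k} → Vec ℕ k → ℕ → ℤ
γ lam j = G lam j j

-- d_k (k ≥ 1).  All natural subtractions below are exact when λ is decreasing.
d : ∀ {k} → Vec ℕ k → ℤ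
d {k} lam with k ≤? 1
... | yes _ = + (at lam 1 +ℕ 1)
... | no  _ =
    Σ1 (k ∸ 1) (λ i →
      (Cz (at lam i +ℕ (k ∸ i) +ℕ 1) (k +ℕ 1 ∸ i)
       - Cz ((at lam i ∸ at lam k) +ℕ (k ∸ i)) (k +ℕ 1 ∸ i)) * γ lam i)
    - Σ1 (k ∸ 2) (λ i →
      + (at lam k +ℕ 1) * Cz ((at lam i ∸ at lam (k ∸ 1)) +ℕ (k ∸ i ∸ 1)) (k ∸ i) * γ lam i)

module Submission where

open import Defs
open import Data.Nat using (ℕ; suc)
open import Data.Integer using (+_)
open import Data.Fin using (Fin)
open import Data.Vec using (Vec)
open import Data.Product using (Σ; _×_)
open import Function.Bundles using (_↔_)
open import Relation.Binary.PropositionalEquality using (_≡_)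

open import Data.Nat using (zero; _∸_; _≤_; _<_; _⊓_; z≤n; s≤s; _≤?_) renaming (_+_ to _+ℕ_)
open import Data.Nat.Properties
open import Data.Nat.Combinatorics using (_C_; k>n⇒nCk≡0; nC1≡n; nCk+nC[k+1]≡[n+1]C[k+1])
open import Data.Integer using (ℤ; _+_; _-_; _*_; -_)
import Data.Integer.Properties as ℤ
open import Data.Integer.Solver using (module +-*-Solver)
open import Data.Fin using (toℕ)
open import Data.Fin.Properties using (+↔⊎; 1↔⊤)
open import Data.Vec using ([]; _∷_)
open import Data.Vec.Relation.Binary.Pointwise.Inductive using ([]; _∷_)
open import Data.Product using (_,_; proj₁)
open import Data.Sum using (_⊎_; inj₁; inj₂)
open import Data.Sum.Function.Propositional using (_⊎-cong_)
open import Data.Unit using (⊤; tt)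
open import Function.Bundles using (mk↔ₛ′)
open import Function.Properties.Inverse using (↔-sym; ↔-trans)
open import Algebra.Properties.CommutativeMonoid.Sum +-0-commutativeMonoid
  using (sum-syntax; ∑-distrib-+; sum-cong-≗; sum-replicate-zero)
open import Relation.Nullary using (yes; no; contradiction)
open import Relation.Binary.PropositionalEquality using (refl; sym; trans; cong; cong₂; module ≡-Reasoning)

open +-*-Solver using (solve; _:=_; _:+_; _:*_; _:-_; :-_; con)

-- Let #chains j x count the chains λ₁ ≥ μ₁ ≥ ⋯ ≥ μⱼ ≥ x with μᵢ ≤ λᵢ, so that the
-- sub-diagrams are counted by #chains k 0.  Splitting off the first row turns the
-- sub-diagrams into a Fin-indexed sum of sub-diagrams of fewer rows, which gives the
-- bijection with Fin.  Splitting off the last row gives the backward recurrence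
--   #chains (j+1) x = #chains j x + #chains (j+1) (x+1)   (x ≤ λⱼ₊₁),
--   #chains (j+1) (λⱼ₊₁ + 1) = 0.
-- By Pascal's rule Fⱼ(x) = Σ_{i ≤ j+1} γᵢ C(λᵢ - x + j - i + 1, j - i + 1) satisfies the
-- same recurrence, and the recursion defining γⱼ₊₂ is exactly the boundary condition
-- Fⱼ₊₁(λⱼ₊₁ + 1) = 0.  So #chains j = Fⱼ by induction on j, and Fₖ(0) = dₖ.

backward-recurrence-unique : ∀ {A : Set} (φ : ℕ → A → A) {f g : ℕ → A} n →
  (∀ x → x ≤ n → f x ≡ φ x (f (suc x))) → (∀ x → x ≤ n → g x ≡ φ x (g (suc x))) →
  f (suc n) ≡ g (suc n) → ∀ x → x ≤ suc n → f x ≡ g x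
backward-recurrence-unique φ {f} {g} n f-rec g-rec f≡g x x≤1+n =
  from-distance (suc n ∸ x) x (m∸n+n≡m x≤1+n)
  where
  from-distance : ∀ t x → t +ℕ x ≡ suc n → f x ≡ g x
  from-distance zero    x refl  = f≡g
  from-distance (suc t) x t+x≡n = begin
    f x               ≡⟨ f-rec x x≤n ⟩
    φ x (f (suc x))   ≡⟨ cong (φ x) (from-distance t (suc x) (trans (+-suc t x) t+x≡n)) ⟩
    φ x (g (suc x))   ≡⟨ g-rec x x≤n ⟨
    g x               ∎
    where
    open ≡-Reasoning
    x≤n = ≤-trans (m≤n+m x t) (≤-reflexive (suc-injective t+x≡n))

Σ<suc↔⊎ : (P : ℕ → Set) (n : ℕ) →
  Σ ℕ (λ y → y < suc n × P y) ↔ (P 0 ⊎ Σ ℕ (λ y → y < n × P (suc y)))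
Σ<suc↔⊎ P n = mk↔ₛ′ to from to∘from from∘to
  where
  to : Σ ℕ (λ y → y < suc n × P y) → P 0 ⊎ Σ ℕ (λ y → y < n × P (suc y))
  to (zero  , _       , p) = inj₁ p
  to (suc y , s≤s y<n , p) = inj₂ (y , y<n , p)
  from : P 0 ⊎ Σ ℕ (λ y → y < n × P (suc y)) → Σ ℕ (λ y → y < suc n × P y)
  from (inj₁ p)             = zero , s≤s z≤n , p
  from (inj₂ (y , y<n , p)) = suc y , s≤s y<n , p
  to∘from : ∀ s → to (from s) ≡ s
  to∘from (inj₁ _) = refl
  to∘from (inj₂ _) = refl
  from∘to : ∀ s → from (to s) ≡ s
  from∘to (zero  , s≤s z≤n , _) = refl
  from∘to (suc _ , s≤s _   , _) = refl

Σ<↔Fin-sum : {P : ℕ → Set} (f : ℕ → ℕ) → (∀ y → P y ↔ Fin (f y)) →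
  ∀ n → Σ ℕ (λ y → y < n × P y) ↔ Fin (∑[ i < n ] f (toℕ i))
Σ<↔Fin-sum     f P↔f zero    = mk↔ₛ′ (λ ()) (λ ()) (λ ()) (λ ())
Σ<↔Fin-sum {P} f P↔f (suc n) = ↔-trans (Σ<suc↔⊎ P n)
  (↔-trans (P↔f 0 ⊎-cong Σ<↔Fin-sum (λ y → f (suc y)) (λ y → P↔f (suc y)) n) (↔-sym +↔⊎))

Σ1-cong : ∀ n {f g : ℕ → ℤ} → (∀ {i} → 1 ≤ i → i ≤ n → f i ≡ g i) → Σ1 n f ≡ Σ1 n g
Σ1-cong zero    f≡g = refl
Σ1-cong (suc n) f≡g =
  cong₂ _+_ (Σ1-cong n (λ 1≤i i≤n → f≡g 1≤i (m≤n⇒m≤1+n i≤n))) (f≡g (s≤s z≤n) ≤-refl)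

Σ1-distrib-+ : ∀ n (f g : ℕ → ℤ) → Σ1 n (λ i → f i + g i) ≡ Σ1 n f + Σ1 n g
Σ1-distrib-+ zero    f g = refl
Σ1-distrib-+ (suc n) f g rewrite Σ1-distrib-+ n f g =
  solve 4 (λ a b c d → (a :+ b) :+ (c :+ d) := (a :+ c) :+ (b :+ d)) refl
    (Σ1 n f) (Σ1 n g) (f (suc n)) (g (suc n))

Σ1-distrib-- : ∀ n (f g : ℕ → ℤ) → Σ1 n (λ i → f i - g i) ≡ Σ1 n f - Σ1 n g
Σ1-distrib-- zero    f g = refl
Σ1-distrib-- (suc n) f g rewrite Σ1-distrib-- n f g =
  solve 4 (λ a b c d → (a :- b) :+ (c :- d) := (a :+ c) :- (b :+ d)) refl
    (Σ1 n f) (Σ1 n g) (f (suc n)) (g (suc n))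

Σ1-*ˡ : ∀ n c (f : ℕ → ℤ) → Σ1 n (λ i → c * f i) ≡ c * Σ1 n f
Σ1-*ˡ zero    c f = sym (ℤ.*-zeroʳ c)
Σ1-*ˡ (suc n) c f rewrite Σ1-*ˡ n c f = sym (ℤ.*-distribˡ-+ c (Σ1 n f) (f (suc n)))

multichoose : ℕ → ℕ → ℕ
multichoose n       zero    = 1
multichoose zero    (suc k) = 0
multichoose (suc n) (suc k) = multichoose n (suc k) +ℕ multichoose (suc n) k

multichoose-suc  : ∀ n k → multichoose n (suc k) ≡ (n +ℕ k) C suc k
multichoose-sucˡ : ∀ n k → multichoose (suc n) k ≡ (n +ℕ k) C k

multichoose-suc zero    k = sym (k>n⇒nCk≡0 (n<1+n k))
multichoose-suc (suc n) k = begin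
  multichoose n (suc k) +ℕ multichoose (suc n) k ≡⟨ cong₂ _+ℕ_ (multichoose-suc n k) (multichoose-sucˡ n k) ⟩
  (n +ℕ k) C suc k +ℕ (n +ℕ k) C k               ≡⟨ +-comm _ ((n +ℕ k) C k) ⟩
  (n +ℕ k) C k +ℕ (n +ℕ k) C suc k               ≡⟨ nCk+nC[k+1]≡[n+1]C[k+1] (n +ℕ k) k ⟩
  suc (n +ℕ k) C suc k                           ∎
  where open ≡-Reasoning

multichoose-sucˡ n zero    = refl
multichoose-sucˡ n (suc k) = trans (multichoose-suc (suc n) k) (cong (_C suc k) (sym (+-suc n k)))

multichoose-1 : ∀ n → multichoose n 1 ≡ n
multichoose-1 n = trans (multichoose-suc n 0) (trans (nC1≡n (n +ℕ 0)) (+-identityʳ n))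

suc∸∸1 : ∀ m n → suc m ∸ n ∸ 1 ≡ m ∸ n
suc∸∸1 m n = trans (∸-+-assoc (suc m) n 1) (cong (suc m ∸_) (+-comm n 1))

HeadAtMost : ∀ {k} → ℕ → Vec ℕ k → Set
HeadAtMost b []      = ⊤
HeadAtMost b (m ∷ _) = m ≤ b

HeadAtMost-irrelevant : ∀ {k b} (v : Vec ℕ k) (p q : HeadAtMost b v) → p ≡ q
HeadAtMost-irrelevant []      tt tt = refl
HeadAtMost-irrelevant (_ ∷ _) p  q  = ≤-irrelevant p q

Decreasing-irrelevant : ∀ {k} {v : Vec ℕ k} (p q : Decreasing v) → p ≡ q
Decreasing-irrelevant []      []      = refl
Decreasing-irrelevant [-]     [-]     = refl
Decreasing-irrelevant (a ∷ p) (b ∷ q) = cong₂ _∷_ (≤-irrelevant a b) (Decreasing-irrelevant p q)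

Decreasing-tail : ∀ {k y} {μ : Vec ℕ k} → Decreasing (y ∷ μ) → Decreasing μ
Decreasing-tail [-]     = []
Decreasing-tail (_ ∷ d) = d

Decreasing-head : ∀ {k y} {μ : Vec ℕ k} → Decreasing (y ∷ μ) → HeadAtMost y μ
Decreasing-head [-]     = tt
Decreasing-head (p ∷ _) = p

Decreasing-cons : ∀ {k y} {μ : Vec ℕ k} → HeadAtMost y μ → Decreasing μ → Decreasing (y ∷ μ)
Decreasing-cons {μ = []}    _ _ = [-]
Decreasing-cons {μ = _ ∷ _} p d = p ∷ d

Decreasing-at-step : ∀ {k} {lam : Vec ℕ k} → Decreasing lam →
  ∀ i → at lam (suc (suc i)) ≤ at lam (suc i)
Decreasing-at-step []      i       = z≤n
Decreasing-at-step [-]     i       = z≤n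
Decreasing-at-step (p ∷ d) zero    = p
Decreasing-at-step (p ∷ d) (suc i) = Decreasing-at-step d i

Decreasing-at-antitone : ∀ {k} {lam : Vec ℕ k} → Decreasing lam →
  ∀ {i j} → i ≤ j → at lam (suc j) ≤ at lam (suc i)
Decreasing-at-antitone d {j = zero}  z≤n = ≤-refl
Decreasing-at-antitone d {j = suc j} i≤j with m≤n⇒m<n∨m≡n i≤j
... | inj₁ i<1+j = ≤-trans (Decreasing-at-step d j) (Decreasing-at-antitone d (≤-pred i<1+j))
... | inj₂ refl  = ≤-refl

[_≤_] : ℕ → ℕ → ℕ
[ zero  ≤ b     ] = 1
[ suc x ≤ zero  ] = 0
[ suc x ≤ suc b ] = [ x ≤ b ]

[≤]-true : ∀ {x b} → x ≤ b → [ x ≤ b ] ≡ 1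
[≤]-true z≤n       = refl
[≤]-true (s≤s x≤b) = [≤]-true x≤b

[≤]-⊓ : ∀ {x c} b → x ≤ c → [ x ≤ b ⊓ c ] ≡ [ x ≤ b ]
[≤]-⊓ b       z≤n       = refl
[≤]-⊓ zero    (s≤s _)   = refl
[≤]-⊓ (suc b) (s≤s x≤c) = [≤]-⊓ b x≤c

∑[≤]-step : ∀ x n →
  ∑[ y < suc n ] [ x ≤ toℕ y ] ≡ [ x ≤ n ] +ℕ ∑[ y < suc n ] [ suc x ≤ toℕ y ]
∑[≤]-step zero    n       = refl
∑[≤]-step (suc x) zero    = refl
∑[≤]-step (suc x) (suc n) = ∑[≤]-step x n

∑[≤]-vanish : ∀ {x n} → n ≤ x → ∑[ y < n ] [ x ≤ toℕ y ] ≡ 0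
∑[≤]-vanish z≤n       = refl
∑[≤]-vanish (s≤s n≤x) = ∑[≤]-vanish n≤x

-- The number of chains b ≥ μ₀ ≥ ⋯ ≥ μₘ₋₁ ≥ x with μᵢ ≤ r i.
#chains : (ℕ → ℕ) → ℕ → ℕ → ℕ → ℕ
#chains r zero    b x = [ x ≤ b ]
#chains r (suc m) b x = ∑[ y < suc (b ⊓ r 0) ] #chains (λ i → r (suc i)) m (toℕ y) x

-- 0-based, unlike at, so that rows (u ∷ w) ∘ suc is definitionally rows w.
rows : ∀ {k} → Vec ℕ k → ℕ → ℕ
rows lam i = at lam (suc i)

#chains-step : ∀ r m b x → x ≤ r m →
  #chains r (suc m) b x ≡ #chains r m b x +ℕ #chains r (suc m) b (suc x)
#chains-step r zero    b x x≤r₀ =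
  trans (∑[≤]-step x (b ⊓ r 0)) (cong (_+ℕ #chains r 1 b (suc x)) ([≤]-⊓ b x≤r₀))
#chains-step r (suc m) b x x≤rₘ =
  trans (sum-cong-≗ {n} (λ y → #chains-step r′ m (toℕ y) x x≤rₘ))
        (∑-distrib-+ {n} (λ y → #chains r′ m (toℕ y) x) (λ y → #chains r′ (suc m) (toℕ y) (suc x)))
  where
  r′ = λ i → r (suc i)
  n  = suc (b ⊓ r 0)

#chains-vanish : ∀ r m b x → r m < x → #chains r (suc m) b x ≡ 0
#chains-vanish r zero    b x r₀<x = ∑[≤]-vanish (≤-trans (s≤s (m⊓n≤n b (r 0))) r₀<x)
#chains-vanish r (suc m) b x rₘ<x =
  trans (sum-cong-≗ {n} (λ y → #chains-vanish (λ i → r (suc i)) m (toℕ y) x rₘ<x))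
        (sum-replicate-zero n)
  where n = suc (b ⊓ r 0)

SubDiagramBelow : ∀ {k} → Vec ℕ k → ℕ → Set
SubDiagramBelow lam b = Σ (SubDiagram lam) (λ s → HeadAtMost b (proj₁ s))

SubDiagram↔SubDiagramBelow : ∀ {k} u (w : Vec ℕ k) → SubDiagram (u ∷ w) ↔ SubDiagramBelow (u ∷ w) u
SubDiagram↔SubDiagramBelow u w = mk↔ₛ′ to proj₁ to∘from from∘to
  where
  to : SubDiagram (u ∷ w) → SubDiagramBelow (u ∷ w) u
  to s@(_ ∷ _ , _ , p ∷ _) = s , p
  to∘from : ∀ s → to (proj₁ s) ≡ s
  to∘from ((_ ∷ _ , _ , p ∷ _) , h) = cong (_ ,_) (≤-irrelevant p h)
  from∘to : ∀ s → proj₁ (to s) ≡ s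
  from∘to (_ ∷ _ , _ , _ ∷ _) = refl

SubDiagramBelow-[]↔⊤ : ∀ b → SubDiagramBelow [] b ↔ ⊤
SubDiagramBelow-[]↔⊤ b = mk↔ₛ′ (λ _ → tt) (λ _ → ([] , [] , []) , tt) (λ _ → refl) from∘to
  where
  from∘to : ∀ s → (([] , [] , []) , tt) ≡ s
  from∘to (([] , [] , []) , tt) = refl

SubDiagramBelow-∷↔ : ∀ {k} u (w : Vec ℕ k) b →
  SubDiagramBelow (u ∷ w) b ↔ Σ ℕ (λ y → y < suc (b ⊓ u) × SubDiagramBelow w y)
SubDiagramBelow-∷↔ u w b = mk↔ₛ′ to from to∘from from∘to
  where
  to : SubDiagramBelow (u ∷ w) b → Σ ℕ (λ y → y < suc (b ⊓ u) × SubDiagramBelow w y)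
  to ((y ∷ μ , d , p ∷ ps) , h) =
    y , s≤s (⊓-glb h p) , (μ , Decreasing-tail d , ps) , Decreasing-head d
  from : Σ ℕ (λ y → y < suc (b ⊓ u) × SubDiagramBelow w y) → SubDiagramBelow (u ∷ w) b
  from (y , s≤s y≤b⊓u , (μ , d , ps) , h) =
    (y ∷ μ , Decreasing-cons h d , ≤-trans y≤b⊓u (m⊓n≤n b u) ∷ ps) , ≤-trans y≤b⊓u (m⊓n≤m b u)
  to∘from : ∀ s → to (from s) ≡ s
  to∘from (y , s≤s _ , (μ , d , ps) , h)
    rewrite Decreasing-irrelevant (Decreasing-tail (Decreasing-cons h d)) d
          | HeadAtMost-irrelevant μ (Decreasing-head (Decreasing-cons h d)) h
    = cong (λ y<1+b⊓u → y , y<1+b⊓u , (μ , d , ps) , h) (≤-irrelevant _ _)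
  from∘to : ∀ s → from (to s) ≡ s
  from∘to ((y ∷ μ , d , p ∷ ps) , h)
    rewrite Decreasing-irrelevant (Decreasing-cons (Decreasing-head d) (Decreasing-tail d)) d
          | ≤-irrelevant (≤-trans (⊓-glb h p) (m⊓n≤n b u)) p
    = cong (_ ,_) (≤-irrelevant _ h)

SubDiagramBelow↔Fin : ∀ {k} (lam : Vec ℕ k) b →
  SubDiagramBelow lam b ↔ Fin (#chains (rows lam) k b 0)
SubDiagramBelow↔Fin         []      b = ↔-trans (SubDiagramBelow-[]↔⊤ b) (↔-sym 1↔⊤)
SubDiagramBelow↔Fin {suc k} (u ∷ w) b = ↔-trans (SubDiagramBelow-∷↔ u w b)
  (Σ<↔Fin-sum (λ y → #chains (rows w) k y 0) (SubDiagramBelow↔Fin w) (suc (b ⊓ u)))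

SubDiagram↔Fin : ∀ n (lam : Vec ℕ (suc n)) →
  SubDiagram lam ↔ Fin (#chains (rows lam) (suc n) (at lam 1) 0)
SubDiagram↔Fin n (u ∷ w) = ↔-trans (SubDiagram↔SubDiagramBelow u w) (SubDiagramBelow↔Fin (u ∷ w) u)

-- C(λᵢ - y + j - i + 1, j - i + 1): the number of chains λᵢ ≥ μᵢ ≥ ⋯ ≥ μⱼ ≥ y.
block : ∀ {k} → Vec ℕ k → ℕ → ℕ → ℕ → ℕ
block lam i j y = multichoose (suc (at lam i) ∸ y) (suc j ∸ i)

module _ {k} (lam : Vec ℕ k) where

  block-pascal : ∀ {i j y} → i ≤ suc j → y ≤ at lam i →
    block lam i (suc j) y ≡ block lam i j y +ℕ block lam i (suc j) (suc y)
  block-pascal {i} {j} {y} i≤1+j y≤λᵢ rewrite +-∸-assoc 1 y≤λᵢ | +-∸-assoc 1 i≤1+j =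
    +-comm (multichoose (at lam i ∸ y) (suc (suc j ∸ i))) _

  block-above-diagonal : ∀ j y → block lam (suc j) j y ≡ 1
  block-above-diagonal j y rewrite n∸n≡0 j = refl

  block-vanish : ∀ {i j y} → at lam i < y → i ≤ j → block lam i j y ≡ 0
  block-vanish λᵢ<y i≤j rewrite m≤n⇒m∸n≡0 λᵢ<y | +-∸-assoc 1 i≤j = refl

  block-diagonal : ∀ i → block lam i i 0 ≡ suc (at lam i)
  block-diagonal i rewrite m+n∸n≡m 1 i = multichoose-1 (suc (at lam i))

  block-binomial : ∀ {i j} y → i ≤ j →
    block lam i j y ≡ ((suc (at lam i) ∸ y) +ℕ (suc j ∸ i ∸ 1)) C (suc j ∸ i)
  block-binomial {i} {j} y i≤j rewrite +-∸-assoc 1 i≤j =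
    multichoose-suc (suc (at lam i) ∸ y) (j ∸ i)

γ-coefficient : ∀ {k} → Vec ℕ k → ℕ → ℕ → ℤ
γ-coefficient lam j i = Cz ((at lam i ∸ at lam (j ∸ 1)) +ℕ (j ∸ i ∸ 1)) (j ∸ i)

G-fuel : ∀ {k} (lam : Vec ℕ k) n m {j} → j ≤ suc n → j ≤ suc m → G lam n j ≡ G lam m j
G-fuel lam zero    zero        _   _ = refl
G-fuel lam zero    (suc m) {j} j≤1 _ with j ≤? 1
... | yes _   = refl
... | no  j≰1 = contradiction j≤1 j≰1
G-fuel lam (suc n) zero    {j} _ j≤1 with j ≤? 1
... | yes _   = refl
... | no  j≰1 = contradiction j≤1 j≰1
G-fuel lam (suc n) (suc m) {j} j≤n+2 j≤m+2 with j ≤? 1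
... | yes _ = refl
... | no  _ = cong -_ (Σ1-cong (j ∸ 2) (λ {i} _ i≤j-2 →
      cong (γ-coefficient lam j i *_) (G-fuel lam n m (below j≤n+2 i≤j-2) (below j≤m+2 i≤j-2))))
  where
  below : ∀ {i n} → j ≤ suc (suc n) → i ≤ j ∸ 2 → i ≤ suc n
  below j≤n+2 i≤j-2 = m≤n⇒m≤1+n (≤-trans i≤j-2 (∸-monoˡ-≤ 2 j≤n+2))

γ-rec : ∀ {k} (lam : Vec ℕ k) j →
  γ lam (suc (suc j)) ≡ - Σ1 j (λ i → γ-coefficient lam (suc (suc j)) i * γ lam i)
γ-rec lam j = cong -_ (Σ1-cong j (λ {i} _ i≤j → cong (γ-coefficient lam (suc (suc j)) i *_)
  (G-fuel lam (suc j) i (m≤n⇒m≤1+n (m≤n⇒m≤1+n i≤j)) (n≤1+n i))))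

chainsFormula : ∀ {k} → Vec ℕ k → ℕ → ℕ → ℤ
chainsFormula lam j x = Σ1 (suc j) (λ i → γ lam i * + block lam i j x)

module _ {k} (lam : Vec ℕ k) where

  private
    F = chainsFormula lam
    g = γ lam

  chainsFormula-step : Decreasing lam → ∀ j {x} → x ≤ at lam (suc j) →
    F (suc j) x ≡ F j x + F (suc j) (suc x)
  chainsFormula-step dec j {x} x≤λⱼ₊₁ = begin
    F (suc j) x                                                         ≡⟨⟩
    Σ1 (suc j) (λ i → g i * + block lam i (suc j) x) + g (2 +ℕ j) * + block lam (2 +ℕ j) (suc j) x
      ≡⟨ cong₂ _+_ (Σ1-cong (suc j) pascal) (cong (λ b → g (2 +ℕ j) * + b) above-diagonal) ⟩
    Σ1 (suc j) (λ i → g i * + block lam i j x + g i * + block lam i (suc j) (suc x))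
      + g (2 +ℕ j) * + block lam (2 +ℕ j) (suc j) (suc x)
      ≡⟨ cong₂ _+_ (Σ1-distrib-+ (suc j) (λ i → g i * + block lam i j x)
                                          (λ i → g i * + block lam i (suc j) (suc x))) refl ⟩
    F j x + Σ1 (suc j) (λ i → g i * + block lam i (suc j) (suc x))
      + g (2 +ℕ j) * + block lam (2 +ℕ j) (suc j) (suc x)               ≡⟨ ℤ.+-assoc (F j x) _ _ ⟩
    F j x + F (suc j) (suc x)                                           ∎
    where
    open ≡-Reasoning
    above-diagonal : block lam (2 +ℕ j) (suc j) x ≡ block lam (2 +ℕ j) (suc j) (suc x)
    above-diagonal =
      trans (block-above-diagonal lam (suc j) x) (sym (block-above-diagonal lam (suc j) (suc x)))
    pascal : ∀ {i} → 1 ≤ i → i ≤ suc j →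
      g i * + block lam i (suc j) x ≡ g i * + block lam i j x + g i * + block lam i (suc j) (suc x)
    pascal {suc i} _ i<2+j = begin
      g (suc i) * + block lam (suc i) (suc j) x
        ≡⟨ cong (λ b → g (suc i) * + b) (block-pascal lam i<2+j x≤λᵢ₊₁) ⟩
      g (suc i) * (+ block lam (suc i) j x + + block lam (suc i) (suc j) (suc x))
        ≡⟨ ℤ.*-distribˡ-+ (g (suc i)) _ _ ⟩
      g (suc i) * + block lam (suc i) j x + g (suc i) * + block lam (suc i) (suc j) (suc x) ∎
      where x≤λᵢ₊₁ = ≤-trans x≤λⱼ₊₁ (Decreasing-at-antitone dec (≤-pred i<2+j))

  chainsFormula-boundary : ∀ j → F (suc j) (suc (at lam (suc j))) ≡ + 0
  chainsFormula-boundary j = begin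
    F (suc j) (1 +ℕ λⱼ₊₁)                                               ≡⟨⟩
    Σ1 j (λ i → g i * + block lam i (suc j) (1 +ℕ λⱼ₊₁))
      + g (suc j) * + block lam (suc j) (suc j) (1 +ℕ λⱼ₊₁)
      + g (2 +ℕ j) * + block lam (2 +ℕ j) (suc j) (1 +ℕ λⱼ₊₁)
      ≡⟨ cong₂ _+_ (cong₂ _+_ (Σ1-cong j binomial) (cong (λ b → g (suc j) * + b) vanish))
                   (cong₂ _*_ (γ-rec lam j) (cong +_ (block-above-diagonal lam (suc j) (1 +ℕ λⱼ₊₁)))) ⟩
    S + g (suc j) * + 0 + (- S) * + 1
      ≡⟨ solve 2 (λ s c → s :+ c :* con (+ 0) :+ (:- s) :* con (+ 1) := con (+ 0)) refl S (g (suc j)) ⟩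
    + 0                                                                 ∎
    where
    open ≡-Reasoning
    λⱼ₊₁ = at lam (suc j)
    S = Σ1 j (λ i → γ-coefficient lam (2 +ℕ j) i * g i)
    vanish : block lam (suc j) (suc j) (1 +ℕ λⱼ₊₁) ≡ 0
    vanish = block-vanish lam {suc j} ≤-refl ≤-refl
    binomial : ∀ {i} → 1 ≤ i → i ≤ j →
      g i * + block lam i (suc j) (1 +ℕ λⱼ₊₁) ≡ γ-coefficient lam (2 +ℕ j) i * g i
    binomial {i} _ i≤j = trans
      (cong (λ b → g i * + b) (block-binomial lam (1 +ℕ λⱼ₊₁) (m≤n⇒m≤1+n i≤j)))
      (ℤ.*-comm (g i) _)

module _ {k} (lam : Vec ℕ k) (dec : Decreasing lam) where

  #chains≡chainsFormula : ∀ j x → x ≤ at lam (suc j) →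
    + #chains (rows lam) j (at lam 1) x ≡ chainsFormula lam j x
  #chains≡chainsFormula-suc : ∀ j x → x ≤ suc (at lam (suc j)) →
    + #chains (rows lam) (suc j) (at lam 1) x ≡ chainsFormula lam (suc j) x

  #chains≡chainsFormula zero    x x≤λ₁   = cong +_ ([≤]-true x≤λ₁)
  #chains≡chainsFormula (suc j) x x≤λⱼ₊₂ =
    #chains≡chainsFormula-suc j x (≤-trans x≤λⱼ₊₂ (m≤n⇒m≤1+n (Decreasing-at-step dec j)))

  #chains≡chainsFormula-suc j =
    backward-recurrence-unique (λ x v → chainsFormula lam j x + v) (at lam (suc j))
      chains-rec (λ x → chainsFormula-step lam dec j) boundary
    where
    shorter = #chains (rows lam) j (at lam 1)
    count   = #chains (rows lam) (suc j) (at lam 1)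
    chains-rec : ∀ x → x ≤ at lam (suc j) → + count x ≡ chainsFormula lam j x + + count (suc x)
    chains-rec x x≤λⱼ₊₁ = begin
      + count x                             ≡⟨ cong +_ (#chains-step (rows lam) j (at lam 1) x x≤λⱼ₊₁) ⟩
      + (shorter x +ℕ count (suc x))        ≡⟨ ℤ.pos-+ (shorter x) (count (suc x)) ⟩
      + shorter x + + count (suc x)         ≡⟨ cong (_+ + count (suc x)) (#chains≡chainsFormula j x x≤λⱼ₊₁) ⟩
      chainsFormula lam j x + + count (suc x) ∎
      where open ≡-Reasoning
    boundary : + count (suc (at lam (suc j))) ≡ chainsFormula lam (suc j) (suc (at lam (suc j)))
    boundary = trans (cong +_ (#chains-vanish (rows lam) j (at lam 1) _ ≤-refl))
                     (sym (chainsFormula-boundary lam j))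

leading-binomial : ∀ a k i →
  (suc a +ℕ (suc k ∸ i ∸ 1)) C (suc k ∸ i) ≡ (a +ℕ (k ∸ i) +ℕ 1) C (k +ℕ 1 ∸ i)
leading-binomial a k i rewrite suc∸∸1 k i | +-comm k 1 | +-comm (a +ℕ (k ∸ i)) 1 = refl

γ-coefficient-suc : ∀ {k} (lam : Vec ℕ k) j i →
  γ-coefficient lam (suc j) i ≡ Cz ((at lam i ∸ at lam j) +ℕ (j ∸ i)) (j +ℕ 1 ∸ i)
γ-coefficient-suc lam j i rewrite suc∸∸1 j i | +-comm j 1 = refl

d≡chainsFormula : ∀ n (lam : Vec ℕ (suc n)) → d lam ≡ chainsFormula lam (suc n) 0
d≡chainsFormula zero (u ∷ []) = begin
  + (u +ℕ 1)                        ≡⟨ cong +_ (+-comm u 1) ⟩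
  + suc u                           ≡⟨ solve 1 (λ b → b := con (+ 0) :+ con (+ 1) :* b :+ con (+ 0) :* con (+ 1))
                                               refl (+ suc u) ⟩
  + 0 + + 1 * + suc u + + 0 * + 1   ≡⟨ cong (λ b → + 0 + + 1 * + b + + 0 * + 1) (block-diagonal (u ∷ []) 1) ⟨
  chainsFormula (u ∷ []) 1 0        ∎
  where open ≡-Reasoning
d≡chainsFormula (suc m) lam = begin
  d lam                                                                               ≡⟨⟩
  Σ1 (suc m) (λ i → (A i - B i) * g i) - Σ1 m (λ i → c * γ-coefficient lam k i * g i)
    ≡⟨ cong₂ _-_ (trans (Σ1-cong (suc m) (λ {i} _ _ → distrib (A i) (B i) (g i))) (Σ1-distrib-- (suc m) _ _))
                 (trans (Σ1-cong m (λ {i} _ _ → ℤ.*-assoc c _ (g i))) (Σ1-*ˡ m c _)) ⟩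
  X - Y - c * Z
    ≡⟨ solve 4 (λ x y z c → x :- y :- c :* z := x :+ (:- z) :* c :+ (:- y) :* con (+ 1)) refl X Y Z c ⟩
  X + (- Z) * c + (- Y) * + 1
    ≡⟨ cong₂ _+_ (cong₂ _+_ (sym (Σ1-cong (suc m) leading)) (cong₂ _*_ (sym (γ-rec lam m)) (cong +_ (sym diagonal))))
                 (cong₂ _*_ (sym γₖ₊₁) (cong +_ (sym (block-above-diagonal lam k 0)))) ⟩
  Σ1 (suc m) (λ i → g i * + block lam i k 0) + g k * + block lam k k 0 + g (suc k) * + block lam (suc k) k 0
                                                                                      ≡⟨⟩
  chainsFormula lam k 0                                                               ∎
  where
  open ≡-Reasoning
  k = 2 +ℕ m
  g = γ lam
  c = + (at lam k +ℕ 1)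
  A B : ℕ → ℤ
  A i = Cz (at lam i +ℕ (k ∸ i) +ℕ 1) (k +ℕ 1 ∸ i)
  B i = Cz ((at lam i ∸ at lam k) +ℕ (k ∸ i)) (k +ℕ 1 ∸ i)
  X = Σ1 (suc m) (λ i → A i * g i)
  Y = Σ1 (suc m) (λ i → B i * g i)
  Z = Σ1 m (λ i → γ-coefficient lam k i * g i)
  distrib : ∀ a b x → (a - b) * x ≡ a * x - b * x
  distrib = solve 3 (λ a b x → (a :- b) :* x := a :* x :- b :* x) refl
  leading : ∀ {i} → 1 ≤ i → i ≤ suc m → g i * + block lam i k 0 ≡ A i * g i
  leading {i} _ i≤1+m = trans
    (cong (λ b → g i * + b)
      (trans (block-binomial lam 0 (m≤n⇒m≤1+n i≤1+m)) (leading-binomial (at lam i) k i)))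
    (ℤ.*-comm (g i) (A i))
  diagonal : block lam k k 0 ≡ at lam k +ℕ 1
  diagonal = trans (block-diagonal lam k) (+-comm 1 (at lam k))
  γₖ₊₁ : g (suc k) ≡ - Y
  γₖ₊₁ = trans (γ-rec lam (suc m))
    (cong -_ (Σ1-cong (suc m) (λ {i} _ _ → cong (_* g i) (γ-coefficient-suc lam k i))))

corollary3p6 : (n : ℕ) (lam : Vec ℕ (suc n)) → Decreasing lam →
    Σ ℕ (λ N → (Fin N ↔ SubDiagram lam) × (d lam ≡ + N))
corollary3p6 n lam dec =
  #chains (rows lam) (suc n) (at lam 1) 0 ,
  ↔-sym (SubDiagram↔Fin n lam) ,
  trans (d≡chainsFormula n lam) (sym (#chains≡chainsFormula-suc lam dec n 0 z≤n))
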